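{- With $W(N,k)$ as in the context, let $\Delta W(N,k)=W(N,k+1)-W(N,k)$. Then for $N\ge2$, $$\Delta W(N,N-2)=\theta(\theta-(N-1))[\theta]_{N-2},$$ and for $N\ge3$ and $0\le k\le N-3$, $$\Delta W(N,k)=(N-1)\Delta W(N-1,k)+\theta^2\frac{(N-2)!}{k!}[\theta]_k.$$
   Context: $\theta>0$. $\mathrm{lrm}(\pi)$ is the number of left-to-right maxima of $\pi$ (entries larger than all entries to their left). $[\theta]_k=\theta(\theta+1)\cdots(\theta+k-1)$, $[\theta]_0=1$. A permutation $\pi\in\mathfrak{S}_N$ is $k$-winnable if the strategy that rejects the first $k$ entries and then accepts the first subsequent left-to-right maximum selects the entry $N$. $W(N,k)=\sum_{k\text{ -winnable }\pi\in\mathfrak{S}_N}\theta^{\mathrm{lrm}(\pi)}$ for $0\le k\le N$. -}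

module Defs where

open import Level using (Level)
open import Data.Nat using (ℕ; zero; suc; _∸_; _<ᵇ_; _≡ᵇ_; _⊔_)
open import Data.Nat.Properties using (_!≢0)
open import Data.Nat.Base using (_!; _/_)
open import Data.Bool using (Bool; true; false; if_then_else_)
open import Data.List using (List; []; _∷_; concatMap; map; foldr)
open import Data.Maybe using (Maybe; just; nothing)
open import Algebra.Bundles using (CommutativeRing)
import Algebra.Bundles

-- Permutations of {1,…,N} in one-line notation (list of values).
-- insertEverywhere x l : all lists obtained by inserting x into l.

insertEverywhere : ℕ → List ℕ → List (List ℕ)
insertEverywhere x []       = (x ∷ []) ∷ []
insertEverywhere x (y ∷ ys) = (x ∷ y ∷ ys) ∷ map (y ∷_) (insertEverywhere x ys)

perms : ℕ → List (List ℕ)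
perms zero    = [] ∷ []
perms (suc n) = concatMap (insertEverywhere (suc n)) (perms n)

-- Left-to-right maxima.  Values are ≥ 1, so initial running max 0.

lrmFrom : ℕ → List ℕ → ℕ
lrmFrom m []       = zero
lrmFrom m (x ∷ xs) = if m <ᵇ x then suc (lrmFrom x xs) else lrmFrom m xs

lrm : List ℕ → ℕ
lrm = lrmFrom zero

-- The strategy: reject the first k entries, then accept the first
-- subsequent left-to-right maximum.  selectFrom k m π scans π with
-- running maximum m; k = number of entries still to reject.

selectFrom : ℕ → ℕ → List ℕ → Maybe ℕ
selectFrom k       m []       = nothing
selectFrom zero    m (x ∷ xs) = if m <ᵇ x then just x else selectFrom zero (m ⊔ x) xs
selectFrom (suc k) m (x ∷ xs) = selectFrom k (m ⊔ x) xs

select : ℕ → List ℕ → Maybe ℕ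
select k = selectFrom k zero

winnable : ℕ → ℕ → List ℕ → Bool
winnable N k π with select k π
... | just x  = x ≡ᵇ N
... | nothing = false

-- (N-2)!/k! as a natural number (exact division when k ≤ N-2).
factQuot : ℕ → ℕ → ℕ
factQuot n k = (n ! / k !) {{k !≢0}}

module WDefs {c ℓ : Level} (R : CommutativeRing c ℓ) where
  open CommutativeRing R public
  open import Algebra.Definitions.RawSemiring (Algebra.Bundles.Semiring.rawSemiring semiring) using (_×_)
  open import Algebra.Definitions.RawSemiring (Algebra.Bundles.Semiring.rawSemiring semiring) public using (_^_)

  ι : ℕ → Carrier
  ι n = n × 1#

  rising : Carrier → ℕ → Carrier
  rising θ zero    = 1#
  rising θ (suc k) = rising θ k * (θ + ι k)

  W : Carrier → ℕ → ℕ → Carrier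
  W θ N k = foldr (λ π acc → (if winnable N k π then θ ^ lrm π else 0#) + acc)
                  0# (perms N)

  ΔW : Carrier → ℕ → ℕ → Carrier
  ΔW θ N k = W θ N (suc k) - W θ N k

-- Every π ∈ 𝔖ₙ₊₁ is obtained by inserting n+1 into some σ ∈ 𝔖ₙ at a position p. The strategy
-- rejecting k entries selects n+1 exactly when p ≥ k and σ has no left-to-right maximum at the
-- positions k, …, p−1, and then lrm π is one more than the number of records of σ before p. The
-- classical record generating function Σ_{σ ∈ 𝔖ₙ} ∏_{records j < p of σ} w j = (n!/p!) ∏_{j<p} (w j + j)
-- therefore gives W(n+1,k) = θ Σ_{p=k}^{n} (n!/p!) Q_k(p) with Q_k(p) = [θ]_k k(k+1)⋯(p−1).
-- Peeling off the term p = n gives W(n+1,k) = θ Q_k(n) + n W(n,k), which ΔW inherits, and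
-- Q_{k+1}(p) − Q_k(p) = θ [θ]_k (p−1)!/k! supplies the inhomogeneous term.

module Submission where

open import Defs
open import Level using (Level)
open import Data.Nat using (ℕ; suc; _≤_; _∸_)
open import Data.Product using (_×_)
open import Algebra.Bundles using (CommutativeRing)

open import Data.Bool using (Bool; true; false; if_then_else_; T)
open import Data.Bool.Properties using (T-≡)
open import Data.Empty using (⊥-elim)
open import Data.List using (List; []; _∷_; _++_; map; concatMap; foldr; length)
open import Data.List.Relation.Unary.All as All using (All; []; _∷_)
import Data.List.Relation.Unary.All.Properties as AllP
open import Data.Maybe using (Maybe; just; nothing)
open import Data.Nat as ℕ using (zero; _<_; _/_; _<ᵇ_; _≤ᵇ_; _≡ᵇ_; _⊔_; _!; z≤n; s≤s)
open import Data.Nat.Properties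
  using (≤-refl; <⇒≤; <⇒≱; ≮⇒≥; m<n⇒m<1+n; m≤n⇒m≤1+n; m≤n⇒m<n∨m≡n; ≤-pred; ≤-trans;
         m≤n⇒m⊔n≡n; m≥n⇒m⊔n≡m; ⊔-lub; <⇒<ᵇ; ≤⇒≤ᵇ; ≤ᵇ⇒≤; <ᵇ-reflects-<; ≡⇒≡ᵇ;
         n∸n≡0; m+[n∸m]≡n; *-assoc; *-comm; _!≢0)
open import Data.Nat.Divisibility using (m≤n⇒m!∣n!)
open import Data.Nat.DivMod using (/-congˡ; n/n≡1; m*n/n≡m; m/n*n≡m; *-/-assoc)
open import Data.Product using (_,_)
open import Data.Sum using (inj₁; inj₂)
open import Function using (Equivalence)
open import Relation.Binary.PropositionalEquality as ≡ using (_≡_)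
open import Relation.Nullary using (¬_; contradiction)
open import Relation.Nullary.Reflects using (ofʸ; ofⁿ)

m<n⇒m<ᵇn≡true : ∀ {m n} → m < n → (m <ᵇ n) ≡ true
m<n⇒m<ᵇn≡true m<n = Equivalence.to T-≡ (<⇒<ᵇ m<n)

m≥n⇒m<ᵇn≡false : ∀ {m n} → n ≤ m → (m <ᵇ n) ≡ false
m≥n⇒m<ᵇn≡false {m} {n} n≤m with m <ᵇ n | <ᵇ-reflects-< m n
... | false | _       = ≡.refl
... | true  | ofʸ m<n = contradiction n≤m (<⇒≱ m<n)

1+k≤ᵇ1+j≡k≤ᵇj : ∀ k j → (suc k ≤ᵇ suc j) ≡ (k ≤ᵇ j)
1+k≤ᵇ1+j≡k≤ᵇj zero    j = ≡.refl
1+k≤ᵇ1+j≡k≤ᵇj (suc k) j = ≡.refl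

n≡ᵇn≡true : ∀ n → (n ≡ᵇ n) ≡ true
n≡ᵇn≡true n = Equivalence.to T-≡ (≡⇒≡ᵇ n n ≡.refl)

m<n⇒m≡ᵇn≡false : ∀ {m n} → m < n → (m ≡ᵇ n) ≡ false
m<n⇒m≡ᵇn≡false {zero}  {suc n} _         = ≡.refl
m<n⇒m≡ᵇn≡false {suc m} {suc n} (s≤s m<n) = m<n⇒m≡ᵇn≡false m<n

factQuot-diag : ∀ n → factQuot n n ≡ 1
factQuot-diag n = n/n≡1 (n !) {{n !≢0}}

factQuot-sucˡ : ∀ {n i} → i ≤ n → factQuot (suc n) i ≡ suc n ℕ.* factQuot n i
factQuot-sucˡ {n} {i} i≤n = *-/-assoc (suc n) {{i !≢0}} (m≤n⇒m!∣n! i≤n)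

factQuot-sucʳ : ∀ {n i} → i < n → factQuot n i ≡ suc i ℕ.* factQuot n (suc i)
factQuot-sucʳ {n} {i} i<n = begin
  n ! / i !                       ≡⟨ /-congˡ (≡.sym (m/n*n≡m (m≤n⇒m!∣n! i<n))) ⟩
  q ℕ.* (suc i ℕ.* i !) / i !     ≡⟨ /-congˡ (≡.sym (*-assoc q (suc i) (i !))) ⟩
  q ℕ.* suc i ℕ.* i ! / i !       ≡⟨ m*n/n≡m (q ℕ.* suc i) (i !) ⟩
  q ℕ.* suc i                     ≡⟨ *-comm q (suc i) ⟩
  suc i ℕ.* q                     ∎
  where
  open ≡.≡-Reasoning
  instance
    _ = i !≢0
    _ = suc i !≢0
  q = factQuot n (suc i)

insertAt : ℕ → ℕ → List ℕ → List ℕ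
insertAt zero    x ys       = x ∷ ys
insertAt (suc p) x []       = x ∷ []
insertAt (suc p) x (y ∷ ys) = y ∷ insertAt p x ys

insertEverywhere-All : ∀ {P : ℕ → Set} {x} l → P x → All P l →
  All (λ π → length π ≡ suc (length l) × All P π) (insertEverywhere x l)
insertEverywhere-All []       px []         = (≡.refl , px ∷ []) ∷ []
insertEverywhere-All (y ∷ ys) px (py ∷ pys) =
  (≡.refl , px ∷ py ∷ pys) ∷
  AllP.map⁺ (All.map (λ (e , a) → ≡.cong suc e , py ∷ a) (insertEverywhere-All ys px pys))

Arrangement : ℕ → List ℕ → Set
Arrangement n σ = length σ ≡ n × All (_< suc n) σ

perms-arrangement : ∀ n → All (Arrangement n) (perms n)
perms-arrangement zero    = (≡.refl , []) ∷ []
perms-arrangement (suc n) = AllP.concat⁺ (AllP.map⁺ (All.map inserted (perms-arrangement n)))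
  where
  inserted : ∀ {σ} → Arrangement n σ → All (Arrangement (suc n)) (insertEverywhere (suc n) σ)
  inserted (len , bounded) =
    All.map (λ (e , a) → ≡.trans e (≡.cong suc len) , a)
            (insertEverywhere-All _ ≤-refl (All.map m<n⇒m<1+n bounded))

selectFrom-dominated : ∀ {m} k l → All (_< m) l → selectFrom k m l ≡ nothing
selectFrom-dominated zero    []       []         = ≡.refl
selectFrom-dominated (suc k) []       []         = ≡.refl
selectFrom-dominated {m} zero (y ∷ ys) (y<m ∷ a)
  rewrite m≥n⇒m<ᵇn≡false {m} (<⇒≤ y<m) | m≥n⇒m⊔n≡m (<⇒≤ y<m) = selectFrom-dominated zero ys a
selectFrom-dominated (suc k) (y ∷ ys) (y<m ∷ a)
  rewrite m≥n⇒m⊔n≡m (<⇒≤ y<m) = selectFrom-dominated k ys a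

lrmFrom-dominated : ∀ {m} l → All (_< m) l → lrmFrom m l ≡ 0
lrmFrom-dominated []                  []  = ≡.refl
lrmFrom-dominated {m} (y ∷ ys) (y<m ∷ a) rewrite m≥n⇒m<ᵇn≡false {m} (<⇒≤ y<m) = lrmFrom-dominated ys a

selects : ℕ → Maybe ℕ → Bool
selects N (just x) = x ≡ᵇ N
selects N nothing  = false

winnable≡selects : ∀ N k π → winnable N k π ≡ selects N (select k π)
winnable≡selects N k π with select k π
... | just x  = ≡.refl
... | nothing = ≡.refl

module RecordSums {c ℓ} (R : CommutativeRing c ℓ) where
  open WDefs R hiding (zero)
  open import Relation.Binary.Reasoning.Setoid setoid
  open import Algebra.Properties.Semiring.Mult semiring using (×-homo-1; ×-homo-+; ×1-homo-*)
  open import Algebra.Solver.Ring.NaturalCoefficients.Default commutativeSemiring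
    using (solve; _:=_; _:+_; _:*_; con)

  ι-1 : ι 1 ≈ 1#
  ι-1 = ×-homo-1 1#

  ι-+ : ∀ m n → ι (m ℕ.+ n) ≈ ι m + ι n
  ι-+ = ×-homo-+ 1#

  ι-* : ∀ m n → ι (m ℕ.* n) ≈ ι m * ι n
  ι-* = ×1-homo-*

  ι-factQuot-diag : ∀ n → ι (factQuot n n) ≈ 1#
  ι-factQuot-diag n = trans (reflexive (≡.cong ι (factQuot-diag n))) ι-1

  ι-factQuot-sucˡ : ∀ {n i} → i ≤ n → ι (factQuot (suc n) i) ≈ ι (suc n) * ι (factQuot n i)
  ι-factQuot-sucˡ {n} {i} i≤n = trans (reflexive (≡.cong ι (factQuot-sucˡ i≤n))) (ι-* (suc n) (factQuot n i))

  𝟙 : Bool → Carrier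
  𝟙 true  = 1#
  𝟙 false = 0#

  𝟙-T : ∀ {b} → T b → 𝟙 b ≈ 1#
  𝟙-T {true} _ = refl

  𝟙-¬T : ∀ {b} → ¬ T b → 𝟙 b ≈ 0#
  𝟙-¬T {true}  ¬t = ⊥-elim (¬t _)
  𝟙-¬T {false} _  = refl

  if-else-0-*ˡ : ∀ b a x → (if b then a * x else 0#) ≈ a * (if b then x else 0#)
  if-else-0-*ˡ true  a x = refl
  if-else-0-*ˡ false a x = sym (zeroʳ a)

  ∑ : ℕ → (ℕ → Carrier) → Carrier
  ∑ zero    f = 0#
  ∑ (suc n) f = f 0 + ∑ n (λ j → f (suc j))

  syntax ∑ n (λ j → e) = ∑[ j < n ] e

  ∑-cong : ∀ n {f g} → (∀ j → j < n → f j ≈ g j) → ∑ n f ≈ ∑ n g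
  ∑-cong zero    f≈g = refl
  ∑-cong (suc n) f≈g = +-cong (f≈g 0 (s≤s z≤n)) (∑-cong n (λ j j<n → f≈g (suc j) (s≤s j<n)))

  ∑-*ˡ : ∀ n a f → ∑[ j < n ] (a * f j) ≈ a * ∑ n f
  ∑-*ˡ zero    a f = sym (zeroʳ a)
  ∑-*ˡ (suc n) a f = trans (+-cong refl (∑-*ˡ n a (λ j → f (suc j)))) (sym (distribˡ a _ _))

  ∑-snoc : ∀ n f → ∑ (suc n) f ≈ ∑ n f + f n
  ∑-snoc zero    f = trans (+-identityʳ _) (sym (+-identityˡ _))
  ∑-snoc (suc n) f = trans (+-cong refl (∑-snoc n (λ j → f (suc j)))) (sym (+-assoc _ _ _))

  ∑-const : ∀ n a → ∑[ j < n ] a ≈ ι n * a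
  ∑-const zero    a = sym (zeroˡ a)
  ∑-const (suc n) a = trans (+-cong (sym (*-identityˡ a)) (∑-const n a)) (sym (distribʳ a 1# (ι n)))

  ∑-vanish : ∀ n {f} → (∀ j → j < n → f j ≈ 0#) → ∑ n f ≈ 0#
  ∑-vanish n f≈0 = trans (∑-cong n f≈0) (trans (∑-const n 0#) (zeroʳ _))

  ∑-if<ᵇ : ∀ {L i} a b → i ≤ L →
    ∑[ p < L ] (if p <ᵇ i then a p else b) ≈ ∑ i a + ι (L ∸ i) * b
  ∑-if<ᵇ {L}     {zero}  a b _         = trans (∑-const L b) (sym (+-identityˡ _))
  ∑-if<ᵇ {suc L} {suc i} a b (s≤s i≤L) =
    trans (+-cong refl (∑-if<ᵇ (λ p → a (suc p)) b i≤L)) (sym (+-assoc _ _ _))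

  -- The same fold as in W, so that W θ N k is definitionally a sum ∑[ π ∈ perms N ] ….
  ∑ˡ : ∀ {A : Set} → List A → (A → Carrier) → Carrier
  ∑ˡ xs f = foldr (λ x acc → f x + acc) 0# xs

  syntax ∑ˡ xs (λ x → e) = ∑[ x ∈ xs ] e

  module _ {A : Set} where

    ∑ˡ-cong : ∀ {P : A → Set} {f g} xs → All P xs → (∀ {x} → P x → f x ≈ g x) → ∑ˡ xs f ≈ ∑ˡ xs g
    ∑ˡ-cong []       []       f≈g = refl
    ∑ˡ-cong (x ∷ xs) (px ∷ a) f≈g = +-cong (f≈g px) (∑ˡ-cong xs a f≈g)

    ∑ˡ-++ : ∀ xs ys (f : A → Carrier) → ∑ˡ (xs ++ ys) f ≈ ∑ˡ xs f + ∑ˡ ys f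
    ∑ˡ-++ []       ys f = sym (+-identityˡ _)
    ∑ˡ-++ (x ∷ xs) ys f = trans (+-cong refl (∑ˡ-++ xs ys f)) (sym (+-assoc _ _ _))

    ∑ˡ-concatMap : ∀ {B : Set} (g : B → List A) xs f →
      ∑ˡ (concatMap g xs) f ≈ ∑[ y ∈ xs ] ∑ˡ (g y) f
    ∑ˡ-concatMap g []       f = refl
    ∑ˡ-concatMap g (y ∷ ys) f =
      trans (∑ˡ-++ (g y) (concatMap g ys) f) (+-cong refl (∑ˡ-concatMap g ys f))

    ∑ˡ-map : ∀ {B : Set} (h : B → A) xs f → ∑ˡ (map h xs) f ≡ ∑[ y ∈ xs ] f (h y)
    ∑ˡ-map h []       f = ≡.refl
    ∑ˡ-map h (y ∷ ys) f = ≡.cong (f (h y) +_) (∑ˡ-map h ys f)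

    ∑ˡ-*ˡ : ∀ xs a (f : A → Carrier) → ∑[ x ∈ xs ] (a * f x) ≈ a * ∑ˡ xs f
    ∑ˡ-*ˡ []       a f = sym (zeroʳ a)
    ∑ˡ-*ˡ (x ∷ xs) a f = trans (+-cong refl (∑ˡ-*ˡ xs a f)) (sym (distribˡ a _ _))

    ∑ˡ-+ : ∀ xs (f g : A → Carrier) → ∑[ x ∈ xs ] (f x + g x) ≈ ∑ˡ xs f + ∑ˡ xs g
    ∑ˡ-+ []       f g = sym (+-identityˡ 0#)
    ∑ˡ-+ (x ∷ xs) f g = trans (+-cong refl (∑ˡ-+ xs f g))
      (solve 4 (λ a b c d → (a :+ b) :+ (c :+ d) := (a :+ c) :+ (b :+ d)) refl
             (f x) (g x) (∑ˡ xs f) (∑ˡ xs g))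

    ∑ˡ-∑ : ∀ xs n (F : A → ℕ → Carrier) → ∑[ x ∈ xs ] ∑[ j < n ] F x j ≈ ∑[ j < n ] ∑[ x ∈ xs ] F x j
    ∑ˡ-∑ []       n       F = sym (trans (∑-const n 0#) (zeroʳ _))
    ∑ˡ-∑ (x ∷ xs) zero    F = trans (+-identityˡ _) (∑ˡ-∑ xs zero F)
    ∑ˡ-∑ (x ∷ xs) (suc n) F = begin
      (F x 0 + ∑[ j < n ] F x (suc j)) + ∑[ y ∈ xs ] (F y 0 + ∑[ j < n ] F y (suc j))
        ≈⟨ +-cong refl (∑ˡ-+ xs (λ y → F y 0) (λ y → ∑[ j < n ] F y (suc j))) ⟩
      (F x 0 + ∑[ j < n ] F x (suc j)) + (∑[ y ∈ xs ] F y 0 + ∑[ y ∈ xs ] ∑[ j < n ] F y (suc j))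
        ≈⟨ solve 4 (λ a b c d → (a :+ b) :+ (c :+ d) := (a :+ c) :+ (b :+ d)) refl _ _ _ _ ⟩
      (F x 0 + ∑[ y ∈ xs ] F y 0) + (∑[ j < n ] F x (suc j) + ∑[ y ∈ xs ] ∑[ j < n ] F y (suc j))
        ≈⟨ +-cong refl (∑ˡ-∑ (x ∷ xs) n (λ y j → F y (suc j))) ⟩
      (F x 0 + ∑[ y ∈ xs ] F y 0) + ∑[ j < n ] ∑[ y ∈ x ∷ xs ] F y (suc j) ∎

  ∑-insertEverywhere : ∀ x τ (f : List ℕ → Carrier) →
    ∑ˡ (insertEverywhere x τ) f ≈ ∑[ p < suc (length τ) ] f (insertAt p x τ)
  ∑-insertEverywhere x []       f = refl
  ∑-insertEverywhere x (y ∷ ys) f =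
    +-cong refl (trans (reflexive (∑ˡ-map (y ∷_) (insertEverywhere x ys) f))
                       (∑-insertEverywhere x ys (λ π → f (y ∷ π))))

  ∑-perms-suc : ∀ n (f : List ℕ → Carrier) →
    ∑ˡ (perms (suc n)) f ≈ ∑[ σ ∈ perms n ] ∑[ p < suc n ] f (insertAt p (suc n) σ)
  ∑-perms-suc n f = trans (∑ˡ-concatMap (insertEverywhere (suc n)) (perms n) f)
    (∑ˡ-cong (perms n) (perms-arrangement n) λ { {σ} (≡.refl , _) → ∑-insertEverywhere (suc n) σ f })

  recordWeight : (ℕ → Carrier) → ℕ → ℕ → List ℕ → Carrier
  recordWeight w m zero    τ        = 1#
  recordWeight w m (suc i) []       = 1#
  recordWeight w m (suc i) (y ∷ ys) =
    (if m <ᵇ y then w 0 else 1#) * recordWeight (λ j → w (suc j)) (m ⊔ y) i ys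

  recordWeight-dominated : ∀ w {m} i τ → All (_< m) τ → recordWeight w m i τ ≈ 1#
  recordWeight-dominated w zero    τ        _         = refl
  recordWeight-dominated w (suc i) []       _         = refl
  recordWeight-dominated w {m} (suc i) (y ∷ ys) (y<m ∷ a)
    rewrite m≥n⇒m<ᵇn≡false {m} (<⇒≤ y<m) | m≥n⇒m⊔n≡m (<⇒≤ y<m) =
    trans (*-identityˡ _) (recordWeight-dominated (λ j → w (suc j)) i ys a)

  recordWeight-insertAt : ∀ w {m x} i p τ → m < x → All (_< x) τ → p ≤ length τ →
    recordWeight w m i (insertAt p x τ) ≈
      (if p <ᵇ i then w p * recordWeight w m p τ else recordWeight w m i τ)
  recordWeight-insertAt w zero p τ _ _ _ = refl
  recordWeight-insertAt w {m} {x} (suc i) zero τ m<x a _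
    rewrite m<n⇒m<ᵇn≡true m<x | m≤n⇒m⊔n≡n (<⇒≤ m<x) =
    *-cong refl (recordWeight-dominated (λ j → w (suc j)) i τ a)
  recordWeight-insertAt w {m} {x} (suc i) (suc p) (y ∷ ys) m<x (y<x ∷ a) (s≤s p≤ys) =
    trans (*-cong refl (recordWeight-insertAt (λ j → w (suc j)) i p ys (⊔-lub m<x y<x) a p≤ys))
          (push (p <ᵇ i))
    where
    r = if m <ᵇ y then w 0 else 1#
    push : ∀ b {u v z} → r * (if b then u * v else z) ≈ (if b then u * (r * v) else r * z)
    push true  = solve 3 (λ r u v → r :* (u :* v) := u :* (r :* v)) refl r _ _
    push false = refl

  weightedRising : (ℕ → Carrier) → ℕ → Carrier
  weightedRising w zero    = 1#
  weightedRising w (suc i) = weightedRising w i * (w i + ι i)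

  weightedRising-cong : ∀ i {v w} → (∀ j → j < i → v j ≈ w j) → weightedRising v i ≈ weightedRising w i
  weightedRising-cong zero    v≈w = refl
  weightedRising-cong (suc i) v≈w =
    *-cong (weightedRising-cong i (λ j j<i → v≈w j (m<n⇒m<1+n j<i))) (+-cong (v≈w i ≤-refl) refl)

  weightedRising-const : ∀ a i → weightedRising (λ _ → a) i ≡ rising a i
  weightedRising-const a zero    = ≡.refl
  weightedRising-const a (suc i) = ≡.cong (_* (a + ι i)) (weightedRising-const a i)

  ∑-telescope : ∀ w (κ : ℕ → ℕ) i → (∀ j → j < i → κ j ≡ suc j ℕ.* κ (suc j)) →
    ∑[ j < i ] (w j * (ι (κ j) * weightedRising w j)) ≈ ι (i ℕ.* κ i) * weightedRising w i
  ∑-telescope w κ zero    _    = sym (zeroˡ _)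
  ∑-telescope w κ (suc i) peel = begin
    ∑[ j < suc i ] (w j * (ι (κ j) * P j))
      ≈⟨ ∑-snoc i _ ⟩
    ∑[ j < i ] (w j * (ι (κ j) * P j)) + w i * (ι (κ i) * P i)
      ≈⟨ +-cong (∑-telescope w κ i (λ j j<i → peel j (m<n⇒m<1+n j<i))) refl ⟩
    ι (i ℕ.* κ i) * P i + w i * (ι (κ i) * P i)
      ≈⟨ reflexive (≡.cong (λ t → ι (i ℕ.* t) * P i + w i * (ι t * P i)) (peel i ≤-refl)) ⟩
    ι (i ℕ.* K) * P i + w i * (ι K * P i)
      ≈⟨ +-cong (*-cong (ι-* i K) refl) refl ⟩
    ι i * ι K * P i + w i * (ι K * P i)
      ≈⟨ solve 4 (λ a k p v → a :* k :* p :+ v :* (k :* p) := k :* (p :* (v :+ a))) refl _ _ _ _ ⟩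
    ι K * P (suc i) ∎
    where
    P = weightedRising w
    K = suc i ℕ.* κ (suc i)

  ∑-recordWeight-suc : ∀ w n i → i ≤ suc n →
    ∑[ σ ∈ perms (suc n) ] recordWeight w 0 i σ ≈
      ∑[ j < i ] (w j * ∑[ σ ∈ perms n ] recordWeight w 0 j σ)
        + ι (suc n ∸ i) * ∑[ σ ∈ perms n ] recordWeight w 0 i σ
  ∑-recordWeight-suc w n i i≤1+n = begin
    ∑ˡ (perms (suc n)) (recordWeight w 0 i)
      ≈⟨ ∑-perms-suc n _ ⟩
    ∑[ σ ∈ perms n ] ∑[ p < suc n ] recordWeight w 0 i (insertAt p (suc n) σ)
      ≈⟨ ∑ˡ-cong (perms n) (perms-arrangement n) inserted ⟩
    ∑[ σ ∈ perms n ] (∑[ j < i ] (w j * E j σ) + ι (suc n ∸ i) * E i σ)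
      ≈⟨ ∑ˡ-+ (perms n) _ _ ⟩
    ∑[ σ ∈ perms n ] ∑[ j < i ] (w j * E j σ) + ∑[ σ ∈ perms n ] (ι (suc n ∸ i) * E i σ)
      ≈⟨ +-cong (trans (∑ˡ-∑ (perms n) i _) (∑-cong i (λ j _ → ∑ˡ-*ˡ (perms n) (w j) (E j))))
                (∑ˡ-*ˡ (perms n) _ (E i)) ⟩
    ∑[ j < i ] (w j * ∑ˡ (perms n) (E j)) + ι (suc n ∸ i) * ∑ˡ (perms n) (E i) ∎
    where
    E = recordWeight w 0
    inserted : ∀ {σ} → Arrangement n σ →
      ∑[ p < suc n ] E i (insertAt p (suc n) σ) ≈ ∑[ j < i ] (w j * E j σ) + ι (suc n ∸ i) * E i σ
    inserted (≡.refl , a) =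
      trans (∑-cong (suc n) (λ p p≤n → recordWeight-insertAt w i p _ (s≤s z≤n) a (≤-pred p≤n)))
            (∑-if<ᵇ _ _ i≤1+n)

  module _ (w : ℕ → Carrier) (n : ℕ) where
    private
      E : ℕ → ℕ → Carrier
      E m i = ∑[ σ ∈ perms m ] recordWeight w 0 i σ
      P = weightedRising w
      κ = factQuot n

    ClosedForm : Set ℓ
    ClosedForm = ∀ j → j ≤ n → E n j ≈ ι (κ j) * P j

    ∑-recordWeight-prefix : ClosedForm → ∀ {i} → i ≤ n →
      ∑[ j < i ] (w j * E n j) ≈ ι (i ℕ.* κ i) * P i
    ∑-recordWeight-prefix closed {i} i≤n = trans
      (∑-cong i (λ j j<i → *-cong refl (closed j (<⇒≤ (≤-trans j<i i≤n)))))
      (∑-telescope w κ i (λ j j<i → factQuot-sucʳ (≤-trans j<i i≤n)))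

    closedForm-suc : ClosedForm → ∀ {i} → i ≤ n → E (suc n) i ≈ ι (factQuot (suc n) i) * P i
    closedForm-suc closed {i} i≤n = begin
      E (suc n) i
        ≈⟨ ∑-recordWeight-suc w n i (m≤n⇒m≤1+n i≤n) ⟩
      ∑[ j < i ] (w j * E n j) + ι (suc n ∸ i) * E n i
        ≈⟨ +-cong (∑-recordWeight-prefix closed i≤n) (*-cong refl (closed i i≤n)) ⟩
      ι (i ℕ.* κ i) * P i + ι (suc n ∸ i) * (ι (κ i) * P i)
        ≈⟨ +-cong (*-cong (ι-* i (κ i)) refl) refl ⟩
      ι i * ι (κ i) * P i + ι (suc n ∸ i) * (ι (κ i) * P i)
        ≈⟨ solve 4 (λ a b k p → a :* k :* p :+ b :* (k :* p) := (a :+ b) :* k :* p) refl _ _ _ _ ⟩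
      (ι i + ι (suc n ∸ i)) * ι (κ i) * P i
        ≈⟨ *-cong (*-cong (trans (sym (ι-+ i (suc n ∸ i))) (reflexive (≡.cong ι (m+[n∸m]≡n (m≤n⇒m≤1+n i≤n)))))
                          refl) refl ⟩
      ι (suc n) * ι (κ i) * P i
        ≈⟨ *-cong (sym (ι-factQuot-sucˡ i≤n)) refl ⟩
      ι (factQuot (suc n) i) * P i ∎

    closedForm-suc-top : ClosedForm → E (suc n) (suc n) ≈ ι (factQuot (suc n) (suc n)) * P (suc n)
    closedForm-suc-top closed = begin
      E (suc n) (suc n)
        ≈⟨ ∑-recordWeight-suc w n (suc n) ≤-refl ⟩
      ∑[ j < suc n ] (w j * E n j) + ι (n ∸ n) * E n (suc n)
        ≈⟨ +-cong (∑-snoc n _) (trans (*-cong (reflexive (≡.cong ι (n∸n≡0 n))) refl) (zeroˡ _)) ⟩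
      ∑[ j < n ] (w j * E n j) + w n * E n n + 0#
        ≈⟨ trans (+-identityʳ _)
                 (+-cong (∑-recordWeight-prefix closed ≤-refl) (*-cong refl (closed n ≤-refl))) ⟩
      ι (n ℕ.* κ n) * P n + w n * (ι (κ n) * P n)
        ≈⟨ +-cong (*-cong (ι-* n (κ n)) refl) refl ⟩
      ι n * ι (κ n) * P n + w n * (ι (κ n) * P n)
        ≈⟨ +-cong (*-cong (*-cong refl (ι-factQuot-diag n)) refl) (*-cong refl (*-cong (ι-factQuot-diag n) refl)) ⟩
      ι n * 1# * P n + w n * (1# * P n)
        ≈⟨ solve 3 (λ a p v → a :* con 1 :* p :+ v :* (con 1 :* p) := con 1 :* (p :* (v :+ a))) refl _ _ _ ⟩
      1# * P (suc n)
        ≈⟨ *-cong (sym (ι-factQuot-diag (suc n))) refl ⟩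
      ι (factQuot (suc n) (suc n)) * P (suc n) ∎

  -- Σ_{σ ∈ 𝔖ₙ} ∏_{records j < i of σ} w j = (n!/i!) ∏_{j<i} (w j + j): the relative order of the first
  -- i entries is uniform, and the j-th of them is a record for exactly one of its j+1 relative ranks.
  ∑-recordWeight : ∀ w n i → i ≤ n →
    ∑[ σ ∈ perms n ] recordWeight w 0 i σ ≈ ι (factQuot n i) * weightedRising w i
  ∑-recordWeight w zero    zero _ = trans (+-identityʳ 1#) (sym (trans (*-identityʳ _) ι-1))
  ∑-recordWeight w (suc n) i i≤1+n with m≤n⇒m<n∨m≡n i≤1+n
  ... | inj₁ (s≤s i≤n) = closedForm-suc w n (∑-recordWeight w n) i≤n
  ... | inj₂ ≡.refl    = closedForm-suc-top w n (∑-recordWeight w n)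

module Winning {c ℓ} (R : CommutativeRing c ℓ) (θ : CommutativeRing.Carrier R) where
  open WDefs R hiding (zero)
  open RecordSums R
  open import Relation.Binary.Reasoning.Setoid setoid
  open import Algebra.Properties.Ring ring using (x[y-z]≈xy-xz; -‿distribˡ-*; -‿distribʳ-*)
  open import Algebra.Properties.AbelianGroup +-abelianGroup using (⁻¹-∙-comm; //-cong₂)
  open import Algebra.Solver.Ring.NaturalCoefficients.Default commutativeSemiring
    using (solve; _:=_; _:+_; _:*_; con)

  winWeight : ℕ → ℕ → ℕ → List ℕ → Carrier
  winWeight N k m π = if selects N (selectFrom k m π) then θ ^ lrmFrom m π else 0#

  winWeight-reject : ∀ N k m y π →
    winWeight N (suc k) m (y ∷ π) ≈ (if m <ᵇ y then θ else 1#) * winWeight N k (m ⊔ y) π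
  winWeight-reject N k m y π with m <ᵇ y | <ᵇ-reflects-< m y
  ... | true  | ofʸ m<y rewrite m≤n⇒m⊔n≡n (<⇒≤ m<y) = if-else-0-*ˡ (selects N (selectFrom k y π)) θ _
  ... | false | ofⁿ m≮y rewrite m≥n⇒m⊔n≡m (≮⇒≥ m≮y) = sym (*-identityˡ _)

  -- A record among the k rejected entries weighs θ; a record after them would be accepted instead of N.
  cutoffWeight : ℕ → ℕ → Carrier
  cutoffWeight zero    j       = 0#
  cutoffWeight (suc k) zero    = θ
  cutoffWeight (suc k) (suc j) = cutoffWeight k j

  cutoffWeight-below : ∀ {k j} → j < k → cutoffWeight k j ≈ θ
  cutoffWeight-below {suc k} {zero}  _         = refl
  cutoffWeight-below {suc k} {suc j} (s≤s j<k) = cutoffWeight-below j<k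

  cutoffWeight-above : ∀ {k j} → k ≤ j → cutoffWeight k j ≈ 0#
  cutoffWeight-above {zero}  {j}     _         = refl
  cutoffWeight-above {suc k} {suc j} (s≤s k≤j) = cutoffWeight-above k≤j

  winWeight-insertAt : ∀ k p {m x} τ → m < x → All (_< x) τ → p ≤ length τ →
    winWeight x k m (insertAt p x τ) ≈ θ * (𝟙 (k ≤ᵇ p) * recordWeight (cutoffWeight k) m p τ)
  winWeight-insertAt zero zero {m} {x} τ m<x a _
    rewrite m<n⇒m<ᵇn≡true m<x | n≡ᵇn≡true x | lrmFrom-dominated τ a = *-cong refl (sym (*-identityˡ 1#))
  winWeight-insertAt (suc k) zero {m} {x} τ m<x a _
    rewrite m≤n⇒m⊔n≡n (<⇒≤ m<x) | selectFrom-dominated k τ a =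
    sym (trans (*-cong refl (zeroˡ _)) (zeroʳ θ))
  winWeight-insertAt zero (suc p) {m} {x} (y ∷ ys) m<x (y<x ∷ a) (s≤s p≤ys)
    with m <ᵇ y | <ᵇ-reflects-< m y
  ... | true  | ofʸ _ rewrite m<n⇒m≡ᵇn≡false y<x =
    sym (trans (*-cong refl (trans (*-identityˡ _) (zeroˡ _))) (zeroʳ θ))
  ... | false | ofⁿ m≮y rewrite m≥n⇒m⊔n≡m (≮⇒≥ m≮y) =
    trans (winWeight-insertAt zero p ys m<x a p≤ys) (*-cong refl (*-cong refl (sym (*-identityˡ _))))
  winWeight-insertAt (suc k) (suc p) {m} {x} (y ∷ ys) m<x (y<x ∷ a) (s≤s p≤ys)
    rewrite 1+k≤ᵇ1+j≡k≤ᵇj k p = begin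
    winWeight x (suc k) m (y ∷ insertAt p x ys)
      ≈⟨ winWeight-reject x k m y (insertAt p x ys) ⟩
    r * winWeight x k (m ⊔ y) (insertAt p x ys)
      ≈⟨ *-cong refl (winWeight-insertAt k p ys (⊔-lub m<x y<x) a p≤ys) ⟩
    r * (θ * (𝟙 (k ≤ᵇ p) * recordWeight (cutoffWeight k) (m ⊔ y) p ys))
      ≈⟨ solve 4 (λ r t b q → r :* (t :* (b :* q)) := t :* (b :* (r :* q))) refl r θ _ _ ⟩
    θ * (𝟙 (k ≤ᵇ p) * (r * recordWeight (cutoffWeight k) (m ⊔ y) p ys)) ∎
    where r = if m <ᵇ y then θ else 1#

  cutRising : ℕ → ℕ → Carrier
  cutRising k = weightedRising (cutoffWeight k)

  cutRising-below : ∀ {k j} → j ≤ k → cutRising k j ≈ rising θ j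
  cutRising-below {k} {j} j≤k =
    trans (weightedRising-cong j (λ i i<j → cutoffWeight-below (≤-trans i<j j≤k)))
          (reflexive (weightedRising-const θ j))

  cutRising-step : ∀ {k j} → k ≤ j → cutRising k (suc j) ≈ cutRising k j * ι j
  cutRising-step k≤j = *-cong refl (trans (+-cong (cutoffWeight-above k≤j) refl) (+-identityˡ _))

  cutRising-suc : ∀ {k m} → k ≤ m →
    cutRising (suc k) (suc m) ≈ cutRising k (suc m) + θ * ι (factQuot m k) * rising θ k
  cutRising-suc {k} {m} k≤m with m≤n⇒m<n∨m≡n k≤m
  ... | inj₂ ≡.refl = begin
    cutRising (suc k) (suc k)
      ≈⟨ cutRising-below {suc k} ≤-refl ⟩
    rising θ k * (θ + ι k)
      ≈⟨ solve 3 (λ r t a → r :* (t :+ a) := r :* a :+ t :* con 1 :* r) refl (rising θ k) θ (ι k) ⟩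
    rising θ k * ι k + θ * 1# * rising θ k
      ≈⟨ +-cong (trans (*-cong (sym (cutRising-below {k} ≤-refl)) refl) (sym (cutRising-step {k} ≤-refl)))
                (*-cong (*-cong refl (sym (ι-factQuot-diag k))) refl) ⟩
    cutRising k (suc k) + θ * ι (factQuot k k) * rising θ k ∎
  ... | inj₁ (s≤s {n = m′} k≤m′) = begin
    cutRising (suc k) (suc (suc m′))
      ≈⟨ cutRising-step (s≤s k≤m′) ⟩
    cutRising (suc k) (suc m′) * ι (suc m′)
      ≈⟨ *-cong (cutRising-suc k≤m′) refl ⟩
    (cutRising k (suc m′) + θ * ι (factQuot m′ k) * rising θ k) * ι (suc m′)
      ≈⟨ solve 5 (λ q t f r l → (q :+ t :* f :* r) :* l := q :* l :+ t :* (l :* f) :* r) refl _ θ _ _ _ ⟩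
    cutRising k (suc m′) * ι (suc m′) + θ * (ι (suc m′) * ι (factQuot m′ k)) * rising θ k
      ≈⟨ +-cong (sym (cutRising-step (m≤n⇒m≤1+n k≤m′))) (*-cong (*-cong refl (sym (ι-factQuot-sucˡ k≤m′))) refl) ⟩
    cutRising k (suc (suc m′)) + θ * ι (factQuot (suc m′) k) * rising θ k ∎

  winTerm : ℕ → ℕ → ℕ → Carrier
  winTerm n k j = 𝟙 (k ≤ᵇ j) * (ι (factQuot n j) * cutRising k j)

  winSum : ℕ → ℕ → Carrier
  winSum n k = ∑ (suc n) (winTerm n k)

  winTerm-below : ∀ n {k j} → j < k → winTerm n k j ≈ 0#
  winTerm-below n {k} {j} j<k = trans (*-cong (𝟙-¬T (λ t → <⇒≱ j<k (≤ᵇ⇒≤ k j t))) refl) (zeroˡ _)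

  winTerm-diag : ∀ n {k} → k ≤ n → winTerm n k n ≈ cutRising k n
  winTerm-diag n k≤n =
    trans (*-cong (𝟙-T (≤⇒≤ᵇ k≤n)) (*-cong (ι-factQuot-diag n) refl))
          (trans (*-identityˡ _) (*-identityˡ _))

  W-suc : ∀ n k → W θ (suc n) k ≈ θ * winSum n k
  W-suc n k = begin
    W θ (suc n) k
      ≈⟨ ∑-perms-suc n _ ⟩
    ∑[ σ ∈ perms n ] ∑[ p < suc n ] F (insertAt p (suc n) σ)
      ≈⟨ ∑ˡ-cong (perms n) (perms-arrangement n) inserted ⟩
    ∑[ σ ∈ perms n ] (θ * ∑[ p < suc n ] (𝟙 (k ≤ᵇ p) * V p σ))
      ≈⟨ ∑ˡ-*ˡ (perms n) θ _ ⟩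
    θ * ∑[ σ ∈ perms n ] ∑[ p < suc n ] (𝟙 (k ≤ᵇ p) * V p σ)
      ≈⟨ *-cong refl (∑ˡ-∑ (perms n) (suc n) (λ σ p → 𝟙 (k ≤ᵇ p) * V p σ)) ⟩
    θ * ∑[ p < suc n ] ∑[ σ ∈ perms n ] (𝟙 (k ≤ᵇ p) * V p σ)
      ≈⟨ *-cong refl (∑-cong (suc n) (λ p p<1+n →
           trans (∑ˡ-*ˡ (perms n) (𝟙 (k ≤ᵇ p)) (V p))
                 (*-cong refl (∑-recordWeight (cutoffWeight k) n p (≤-pred p<1+n))))) ⟩
    θ * winSum n k ∎
    where
    F : List ℕ → Carrier
    F π = if winnable (suc n) k π then θ ^ lrm π else 0#
    V = recordWeight (cutoffWeight k) 0
    inserted : ∀ {σ} → Arrangement n σ →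
      ∑[ p < suc n ] F (insertAt p (suc n) σ) ≈ θ * ∑[ p < suc n ] (𝟙 (k ≤ᵇ p) * V p σ)
    inserted {σ} (≡.refl , a) = trans
      (∑-cong (suc n) (λ p p<1+n →
        trans (reflexive (≡.cong (λ b → if b then _ else 0#)
                                 (winnable≡selects (suc n) k (insertAt p (suc n) σ))))
              (winWeight-insertAt k p σ (s≤s z≤n) a (≤-pred p<1+n))))
      (∑-*ˡ (suc n) θ (λ p → 𝟙 (k ≤ᵇ p) * V p σ))

  winSum-suc : ∀ n k → k ≤ suc n → winSum (suc n) k ≈ cutRising k (suc n) + ι (suc n) * winSum n k
  winSum-suc n k k≤1+n = begin
    winSum (suc n) k
      ≈⟨ ∑-snoc (suc n) (winTerm (suc n) k) ⟩
    ∑[ j < suc n ] winTerm (suc n) k j + winTerm (suc n) k (suc n)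
      ≈⟨ +-cong (∑-cong (suc n) (λ j j<1+n → scaled j (≤-pred j<1+n))) (winTerm-diag (suc n) k≤1+n) ⟩
    ∑[ j < suc n ] (ι (suc n) * winTerm n k j) + cutRising k (suc n)
      ≈⟨ trans (+-cong (∑-*ˡ (suc n) (ι (suc n)) (winTerm n k)) refl) (+-comm _ _) ⟩
    cutRising k (suc n) + ι (suc n) * winSum n k ∎
    where
    scaled : ∀ j → j ≤ n → winTerm (suc n) k j ≈ ι (suc n) * winTerm n k j
    scaled j j≤n = begin
      𝟙 (k ≤ᵇ j) * (ι (factQuot (suc n) j) * cutRising k j)
        ≈⟨ *-cong refl (*-cong (ι-factQuot-sucˡ j≤n) refl) ⟩
      𝟙 (k ≤ᵇ j) * (ι (suc n) * ι (factQuot n j) * cutRising k j)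
        ≈⟨ solve 4 (λ b l f q → b :* (l :* f :* q) := l :* (b :* (f :* q))) refl _ _ _ _ ⟩
      ι (suc n) * winTerm n k j ∎

  winSum-diag : ∀ n → winSum n n ≈ rising θ n
  winSum-diag n = begin
    winSum n n
      ≈⟨ ∑-snoc n (winTerm n n) ⟩
    ∑[ j < n ] winTerm n n j + winTerm n n n
      ≈⟨ +-cong (∑-vanish n (λ j → winTerm-below n)) (winTerm-diag n ≤-refl) ⟩
    0# + cutRising n n
      ≈⟨ trans (+-identityˡ _) (cutRising-below {n} ≤-refl) ⟩
    rising θ n ∎

  winSum-above : ∀ n → winSum n (suc n) ≈ 0#
  winSum-above n = ∑-vanish (suc n) (λ j → winTerm-below n)

  [x+y+z]-[x+w]≈y+[z-w] : ∀ x y z w → (x + y + z) - (x + w) ≈ y + (z - w)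
  [x+y+z]-[x+w]≈y+[z-w] x y z w = begin
    (x + y + z) + - (x + w)    ≈⟨ +-cong refl (sym (⁻¹-∙-comm x w)) ⟩
    (x + y + z) + (- x + - w)  ≈⟨ solve 5 (λ x y z x′ w′ → (x :+ y :+ z) :+ (x′ :+ w′) := (y :+ (z :+ w′)) :+ (x :+ x′))
                                        refl x y z (- x) (- w) ⟩
    y + (z - w) + (x - x)      ≈⟨ +-cong refl (-‿inverseʳ x) ⟩
    y + (z - w) + 0#           ≈⟨ +-identityʳ _ ⟩
    y + (z - w)                ∎

  winSum-Δ-suc : ∀ n k → k ≤ n →
    winSum (suc n) (suc k) - winSum (suc n) k ≈
      θ * ι (factQuot n k) * rising θ k + ι (suc n) * (winSum n (suc k) - winSum n k)
  winSum-Δ-suc n k k≤n = begin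
    winSum (suc n) (suc k) - winSum (suc n) k
      ≈⟨ //-cong₂ (winSum-suc n (suc k) (s≤s k≤n)) (winSum-suc n k (m≤n⇒m≤1+n k≤n)) ⟩
    (cutRising (suc k) (suc n) + ι (suc n) * winSum n (suc k))
      - (cutRising k (suc n) + ι (suc n) * winSum n k)
      ≈⟨ //-cong₂ (+-cong (cutRising-suc k≤n) refl) refl ⟩
    (cutRising k (suc n) + θ * ι (factQuot n k) * rising θ k + ι (suc n) * winSum n (suc k))
      - (cutRising k (suc n) + ι (suc n) * winSum n k)
      ≈⟨ [x+y+z]-[x+w]≈y+[z-w] _ _ _ _ ⟩
    θ * ι (factQuot n k) * rising θ k + (ι (suc n) * winSum n (suc k) - ι (suc n) * winSum n k)
      ≈⟨ +-cong refl (sym (x[y-z]≈xy-xz _ _ _)) ⟩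
    θ * ι (factQuot n k) * rising θ k + ι (suc n) * (winSum n (suc k) - winSum n k) ∎

  winSum-Δ-diag : ∀ n → winSum n (suc n) - winSum n n ≈ - rising θ n
  winSum-Δ-diag n = trans (//-cong₂ (winSum-above n) (winSum-diag n)) (+-identityˡ _)

  ΔW-suc : ∀ n k → ΔW θ (suc n) k ≈ θ * (winSum n (suc k) - winSum n k)
  ΔW-suc n k = trans (//-cong₂ (W-suc n (suc k)) (W-suc n k)) (sym (x[y-z]≈xy-xz θ _ _))

  ΔW-last : ∀ N → 2 ≤ N → ΔW θ N (N ∸ 2) ≈ θ * (θ - ι (N ∸ 1)) * rising θ (N ∸ 2)
  ΔW-last (suc zero)    (s≤s ())
  ΔW-last (suc (suc n)) _ = begin
    ΔW θ (suc (suc n)) n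
      ≈⟨ trans (ΔW-suc (suc n) n) (*-cong refl (winSum-Δ-suc n n ≤-refl)) ⟩
    θ * (θ * ι (factQuot n n) * r + s * (winSum n (suc n) - winSum n n))
      ≈⟨ *-cong refl (+-cong (*-cong (*-cong refl (ι-factQuot-diag n)) refl) (*-cong refl (winSum-Δ-diag n))) ⟩
    θ * (θ * 1# * r + s * - r)
      ≈⟨ *-cong refl (+-cong refl (trans (sym (-‿distribʳ-* s r)) (-‿distribˡ-* s r))) ⟩
    θ * (θ * 1# * r + - s * r)
      ≈⟨ solve 3 (λ t r s′ → t :* (t :* con 1 :* r :+ s′ :* r) := t :* (t :+ s′) :* r) refl θ r (- s) ⟩
    θ * (θ - s) * r ∎
    where
    r = rising θ n
    s = ι (suc n)

  ΔW-recurrence : ∀ N k → 3 ≤ N → k ≤ N ∸ 3 →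
    ΔW θ N k ≈ ι (N ∸ 1) * ΔW θ (N ∸ 1) k + (θ ^ 2) * ι (factQuot (N ∸ 2) k) * rising θ k
  ΔW-recurrence (suc zero)          k (s≤s ())       _
  ΔW-recurrence (suc (suc zero))    k (s≤s (s≤s ())) _
  ΔW-recurrence (suc (suc (suc n))) k _ k≤n = begin
    ΔW θ (suc (suc (suc n))) k
      ≈⟨ trans (ΔW-suc (suc (suc n)) k) (*-cong refl (winSum-Δ-suc (suc n) k (m≤n⇒m≤1+n k≤n))) ⟩
    θ * (θ * ι (factQuot (suc n) k) * rising θ k + L * D)
      ≈⟨ solve 5 (λ t q r l d → t :* (t :* q :* r :+ l :* d) := l :* (t :* d) :+ t :* (t :* con 1) :* q :* r)
               refl θ _ _ L D ⟩
    L * (θ * D) + (θ ^ 2) * ι (factQuot (suc n) k) * rising θ k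
      ≈⟨ +-cong (*-cong refl (sym (ΔW-suc (suc n) k))) refl ⟩
    L * ΔW θ (suc (suc n)) k + (θ ^ 2) * ι (factQuot (suc n) k) * rising θ k ∎
    where
    L = ι (suc (suc n))
    D = winSum (suc n) (suc k) - winSum (suc n) k

corollary4p4 : ∀ {c ℓ} (R : CommutativeRing c ℓ) (θ : CommutativeRing.Carrier R) →
    let open WDefs R in
    (∀ (N : ℕ) → 2 ≤ N →
      ΔW θ N (N ∸ 2) ≈ θ * (θ - ι (N ∸ 1)) * rising θ (N ∸ 2))
    ×
    (∀ (N k : ℕ) → 3 ≤ N → k ≤ N ∸ 3 →
      ΔW θ N k ≈ ι (N ∸ 1) * ΔW θ (N ∸ 1) k
                 + (θ ^ 2) * ι (factQuot (N ∸ 2) k) * rising θ k)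
corollary4p4 R θ = ΔW-last , ΔW-recurrence
  where open Winning R θ
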